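{- Let $c=c(x)$ be a smooth function, $D=\frac{\mathrm{d}}{\mathrm{d}x}$, and $c_k=D^kc$ ($c_0=c$). For every $n\geqslant 1$, $$(cD)^nc=\sum_{p\in\operatorname{OWP}_{n}}\prod_{i=0}^n c_i^{w_i(p)},$$ where $w_i(p)$ is the number of blocks of $p$ with exactly $i$ elements.
   Context: $(cD)^n c$ means applying $n$ times the operator $g\mapsto c\,Dg$ to $c$. $\operatorname{OWP}_n$ is the set of ordered weak set partitions $p=(B_0,B_1,\ldots,B_n)$ of $[n]=\{1,\ldots,n\}$ into $n+1$ pairwise disjoint, possibly empty, blocks with union $[n]$, such that $1\in B_0$ and, for $1\leqslant i\leqslant n$, if $B_i$ is nonempty then $\min B_i>i$. -}

module Defs where

open import Level using (Level; _⊔_)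
open import Algebra.Bundles using (CommutativeRing)
open import Data.Nat as ℕ using (ℕ; zero; suc; _≤_; _<_)
open import Data.Fin as Fin using (Fin; toℕ)
open import Data.Fin.Properties using (all?) renaming (_≟_ to _≟ᶠ_)
open import Data.Vec using (Vec; []; _∷_; lookup)
open import Data.List using (List; []; _∷_; [_]; map; concatMap; filter; length; foldr)
open import Data.List.Base using (allFin)
open import Data.Product using (_×_)
open import Relation.Nullary using (¬_; Dec; yes; no)
open import Relation.Nullary.Decidable using (_×-dec_; _→-dec_; ¬?)
open import Relation.Binary.PropositionalEquality using (_≡_)
open import Function using (_∘_)

-- A commutative differential ring: a commutative ring with a derivation D
-- (additive and satisfying the Leibniz rule). Smooth functions ℝ → ℝ with
-- D = d/dx form such a ring.
record DifferentialRing (c ℓ : Level) : Set (Level.suc (c ⊔ ℓ)) where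
  field
    commutativeRing : CommutativeRing c ℓ
  open CommutativeRing commutativeRing public
  field
    D        : Carrier → Carrier
    D-cong   : ∀ {x y} → x ≈ y → D x ≈ D y
    D-+      : ∀ x y → D (x + y) ≈ D x + D y
    D-*      : ∀ x y → D (x * y) ≈ D x * y + x * D y

module _ {c ℓ : Level} (R : DifferentialRing c ℓ) where
  open DifferentialRing R

  Dⁿ : ℕ → Carrier → Carrier
  Dⁿ zero    x = x
  Dⁿ (suc k) x = D (Dⁿ k x)

  cDpow : Carrier → ℕ → Carrier
  cDpow f zero    = f
  cDpow f (suc n) = f * D (cDpow f n)

  pow : Carrier → ℕ → Carrier
  pow x zero    = 1#
  pow x (suc k) = x * pow x k

  ∑ : List Carrier → Carrier
  ∑ = foldr _+_ 0#

  ∏ : List Carrier → Carrier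
  ∏ = foldr _*_ 1#

-- An ordered weak set partition (B_0,…,B_n) of [n] into n+1 blocks is encoded
-- by its block-assignment map p : Fin n → Fin (suc n), where element j : Fin n
-- stands for the integer toℕ j + 1 ∈ [n], and block index i : Fin (suc n)
-- stands for i ∈ {0,…,n};  B_i = { j | p j ≡ i }.
Assignment : ℕ → Set
Assignment n = Vec (Fin (suc n)) n

allVecs : (k n : ℕ) → List (Vec (Fin k) n)
allVecs k zero    = [ [] ]
allVecs k (suc n) = concatMap (λ a → map (a ∷_) (allVecs k n)) (allFin k)

_∈B[_]_ : ∀ {n} → Fin n → Fin (suc n) → Assignment n → Set
j ∈B[ i ] p = lookup p j ≡ i

IsOWP : ∀ {n} → Assignment n → Set
IsOWP {n} p =
  (∀ (j : Fin n) → toℕ j ≡ 0 → j ∈B[ Fin.zero ] p)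
  × (∀ (i : Fin (suc n)) → ¬ (toℕ i ≡ 0) → ∀ (j : Fin n) → j ∈B[ i ] p → toℕ i < toℕ j ℕ.+ 1)

isOWP? : ∀ {n} (p : Assignment n) → Dec (IsOWP p)
isOWP? {n} p =
  all? (λ j → (toℕ j ℕ.≟ 0) →-dec (lookup p j ≟ᶠ Fin.zero))
  ×-dec all? (λ i → ¬? (toℕ i ℕ.≟ 0) →-dec
                      all? (λ j → (lookup p j ≟ᶠ i) →-dec (toℕ i ℕ.<? toℕ j ℕ.+ 1)))

OWP : (n : ℕ) → List (Assignment n)
OWP n = filter isOWP? (allVecs (suc n) n)

blockSize : ∀ {n} → Assignment n → Fin (suc n) → ℕ
blockSize {n} p i = length (filter (λ j → lookup p j ≟ᶠ i) (allFin n))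

w : ∀ {n} → ℕ → Assignment n → ℕ
w {n} k p = length (filter (λ i → blockSize p i ℕ.≟ k) (allFin (suc n)))

module _ {c ℓ : Level} (R : DifferentialRing c ℓ) where
  open DifferentialRing R

  owpSum : Carrier → (n : ℕ) → Carrier
  owpSum f n = ∑ R (map (λ p → ∏ R (map (λ i → pow R (Dⁿ R (toℕ i) f) (w (toℕ i) p))
                                         (allFin (suc n))))
                        (OWP n))

-- An element of OWP_n is encoded by its block-assignment vector p, and the OWP condition says
-- exactly that element j + 1 lies in a block of index at most j (p is subexcedant).  The
-- subexcedant vectors of length n + 1 are the extensions of those of length n by a last entry
-- b ≤ n.  Putting the new element n + 1 into B_b raises |B_b| by one, i.e. replaces the factor
-- c_|B_b| of the monomial ∏ᵢ c_|Bᵢ| by its derivative, while the new block B_(n+1) stays empty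
-- and contributes c₀ = c.  By the Leibniz rule the sum over b is therefore c · D of the
-- monomial of the shorter vector, which is the recursion (cD)^(n+1) c = c · D ((cD)^n c).

module Submission where

open import Defs
open import Level using (Level)
open import Data.Bool.Base using (Bool; true; false)
open import Data.Nat.Base as ℕ using (ℕ; zero; suc; _≤_; _<_; z≤n; s≤s)
import Data.Nat.Properties as ℕₚ
open import Data.Fin.Base using (Fin; zero; suc; toℕ; inject₁; fromℕ)
open import Data.Fin.Properties
  using (_≟_; toℕ<n; toℕ-inject₁; toℕ-fromℕ; toℕ-injective; inject₁-injective; fromℕ≢inject₁)
open import Data.Fin.Relation.Unary.Top using (view; ‵fromℕ; ‵inject₁)
open import Data.Vec.Base using (Vec; []; _∷_; _∷ʳ_; lookup; map)
open import Data.Vec.Properties using (lookup-map)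
import Data.Vec.Functional as Vector
open import Data.Vec.Functional using (Vector; updateAt)
open import Data.Vec.Functional.Properties using (updateAt-updates; updateAt-minimal; map-updateAt)
open import Data.List.Base as List using (List; []; _∷_; _++_; length; filter; tabulate; allFin; concatMap)
open import Data.List.Properties using (length-tabulate; map-tabulate; map-++; map-∘)
import Data.List.Properties as Listₚ
open import Data.Product.Base using (_×_; _,_; proj₁)
open import Function.Base using (id; _∘_)
open import Function.Bundles using (_⇔_; mk⇔; Equivalence)
open import Function.Definitions using (Injective)
open import Relation.Nullary.Decidable using (does; yes; no; does-⇔; dec-false)
open import Relation.Unary using (Pred; Decidable)
open import Relation.Binary.PropositionalEquality as ≡ using (_≡_; _≢_; module ≡-Reasoning)
import Algebra.Properties.Semiring.Sum ℕₚ.+-*-semiring as ℕΣ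

indicator : Bool → ℕ
indicator true  = 1
indicator false = 0

length-filter-tabulate : ∀ {a p} {A : Set a} {P : Pred A p} (P? : Decidable P) {n} (g : Fin n → A) →
                         length (filter P? (tabulate g)) ≡ ℕΣ.sum (λ j → indicator (does (P? (g j))))
length-filter-tabulate P? {zero}  g = ≡.refl
length-filter-tabulate P? {suc n} g with does (P? (g zero))
... | true  = ≡.cong suc (length-filter-tabulate P? (g ∘ suc))
... | false = length-filter-tabulate P? (g ∘ suc)

updateAt-suc : ∀ {k} (h : Vector ℕ k) (x i : Fin k) → updateAt h x suc i ≡ h i ℕ.+ indicator (does (x ≟ i))
updateAt-suc h x i with x ≟ i
... | yes ≡.refl = ≡.trans (updateAt-updates x h) (ℕₚ.+-comm 1 (h x))
... | no  x≢i  = ≡.trans (updateAt-minimal i x h (x≢i ∘ ≡.sym)) (≡.sym (ℕₚ.+-identityʳ (h i)))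

lookup-∷ʳ-inject₁ : ∀ {a} {A : Set a} {n} (xs : Vec A n) (x : A) (j : Fin n) →
                    lookup (xs ∷ʳ x) (inject₁ j) ≡ lookup xs j
lookup-∷ʳ-inject₁ (y ∷ xs) x zero    = ≡.refl
lookup-∷ʳ-inject₁ (y ∷ xs) x (suc j) = lookup-∷ʳ-inject₁ xs x j

lookup-∷ʳ-fromℕ : ∀ {a} {A : Set a} {n} (xs : Vec A n) (x : A) → lookup (xs ∷ʳ x) (fromℕ n) ≡ x
lookup-∷ʳ-fromℕ []       x = ≡.refl
lookup-∷ʳ-fromℕ (y ∷ xs) x = lookup-∷ʳ-fromℕ xs x

histogram : ∀ {k n} → Vec (Fin k) n → Fin k → ℕ
histogram {n = n} xs i = length (filter (λ j → lookup xs j ≟ i) (allFin n))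

histogram≡sum : ∀ {k n} (xs : Vec (Fin k) n) (i : Fin k) →
                  histogram xs i ≡ ℕΣ.sum (λ j → indicator (does (lookup xs j ≟ i)))
histogram≡sum xs i = length-filter-tabulate (λ j → lookup xs j ≟ i) id

histogram-≤ : ∀ {k n} (xs : Vec (Fin k) n) (i : Fin k) → histogram xs i ≤ n
histogram-≤ {n = n} xs i =
  ℕₚ.≤-trans (Listₚ.length-filter (λ j → lookup xs j ≟ i) (allFin n))
             (ℕₚ.≤-reflexive (length-tabulate id))

histogram-∷ʳ : ∀ {k n} (xs : Vec (Fin k) n) (x i : Fin k) →
               histogram (xs ∷ʳ x) i ≡ updateAt (histogram xs) x suc i
histogram-∷ʳ {k} {n} xs x i = begin
  histogram (xs ∷ʳ x) i
    ≡⟨ histogram≡sum (xs ∷ʳ x) i ⟩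
  ℕΣ.sum (λ j → δ (lookup (xs ∷ʳ x) j))
    ≡⟨ ℕΣ.sum-init-last (λ j → δ (lookup (xs ∷ʳ x) j)) ⟩
  ℕΣ.sum (λ j → δ (lookup (xs ∷ʳ x) (inject₁ j))) ℕ.+ δ (lookup (xs ∷ʳ x) (fromℕ n))
    ≡⟨ ≡.cong₂ ℕ._+_ (ℕΣ.sum-cong-≗ (λ j → ≡.cong δ (lookup-∷ʳ-inject₁ xs x j)))
                     (≡.cong δ (lookup-∷ʳ-fromℕ xs x)) ⟩
  ℕΣ.sum (λ j → δ (lookup xs j)) ℕ.+ δ x
    ≡⟨ ≡.cong (ℕ._+ δ x) (histogram≡sum xs i) ⟨
  histogram xs i ℕ.+ δ x
    ≡⟨ updateAt-suc (histogram xs) x i ⟨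
  updateAt (histogram xs) x suc i ∎
  where
  open ≡-Reasoning
  δ : Fin k → ℕ
  δ y = indicator (does (y ≟ i))

histogram-map : ∀ {k l n} {φ : Fin k → Fin l} → Injective _≡_ _≡_ φ →
                (xs : Vec (Fin k) n) (i : Fin k) → histogram (map φ xs) (φ i) ≡ histogram xs i
histogram-map {φ = φ} φ-inj xs i = begin
  histogram (map φ xs) (φ i)
    ≡⟨ histogram≡sum (map φ xs) (φ i) ⟩
  ℕΣ.sum (λ j → indicator (does (lookup (map φ xs) j ≟ φ i)))
    ≡⟨ ℕΣ.sum-cong-≗ (λ j → ≡.cong indicator (≡.trans (≡.cong (λ y → does (y ≟ φ i)) (lookup-map j φ xs))
                                                       (φ-≟ (lookup xs j)))) ⟩
  ℕΣ.sum (λ j → indicator (does (lookup xs j ≟ i)))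
    ≡⟨ histogram≡sum xs i ⟨
  histogram xs i ∎
  where
  open ≡-Reasoning
  φ-≟ : ∀ y → does (φ y ≟ φ i) ≡ does (y ≟ i)
  φ-≟ y = does-⇔ (mk⇔ φ-inj (≡.cong φ)) (φ y ≟ φ i) (y ≟ i)

histogram-∉ : ∀ {k n} (xs : Vec (Fin k) n) (i : Fin k) → (∀ j → lookup xs j ≢ i) → histogram xs i ≡ 0
histogram-∉ {n = n} xs i ∉xs = begin
  histogram xs i
    ≡⟨ histogram≡sum xs i ⟩
  ℕΣ.sum (λ j → indicator (does (lookup xs j ≟ i)))
    ≡⟨ ℕΣ.sum-cong-≗ (λ j → ≡.cong indicator (dec-false (lookup xs j ≟ i) (∉xs j))) ⟩
  ℕΣ.sum {n} (λ _ → 0)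
    ≡⟨ ℕΣ.sum-replicate-zero n ⟩
  0 ∎
  where open ≡-Reasoning

Subexcedant : ∀ {k n} → Vec (Fin k) n → Set
Subexcedant xs = ∀ j → toℕ (lookup xs j) ≤ toℕ j

subexcedant-lookup≢fromℕ : ∀ {n} {xs : Vec (Fin (suc n)) n} → Subexcedant xs →
                           ∀ j → lookup xs j ≢ fromℕ n
subexcedant-lookup≢fromℕ {n} sub j xs[j]≡n =
  ℕₚ.<-irrefl (toℕ-fromℕ n) (≡.subst (λ y → toℕ y < n) xs[j]≡n (ℕₚ.≤-<-trans (sub j) (toℕ<n j)))

subexcedant-∷ʳ : ∀ {k n} (xs : Vec (Fin k) n) (x : Fin k) →
                 Subexcedant (xs ∷ʳ x) ⇔ (Subexcedant xs × toℕ x ≤ n)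
subexcedant-∷ʳ {n = n} xs x = mk⇔ to from
  where
  to : Subexcedant (xs ∷ʳ x) → Subexcedant xs × toℕ x ≤ n
  to sub = (λ j → ≡.subst₂ _≤_ (≡.cong toℕ (lookup-∷ʳ-inject₁ xs x j)) (toℕ-inject₁ j) (sub (inject₁ j)))
         , ≡.subst₂ _≤_ (≡.cong toℕ (lookup-∷ʳ-fromℕ xs x)) (toℕ-fromℕ n) (sub (fromℕ n))
  from : Subexcedant xs × toℕ x ≤ n → Subexcedant (xs ∷ʳ x)
  from (sub , x≤n) j with view j
  ... | ‵fromℕ     = ≡.subst₂ _≤_ (≡.sym (≡.cong toℕ (lookup-∷ʳ-fromℕ xs x))) (≡.sym (toℕ-fromℕ n)) x≤n
  ... | ‵inject₁ i = ≡.subst₂ _≤_ (≡.sym (≡.cong toℕ (lookup-∷ʳ-inject₁ xs x i))) (≡.sym (toℕ-inject₁ i)) (sub i)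

subexcedant-map-inject₁ : ∀ {k n} (xs : Vec (Fin k) n) → Subexcedant (map inject₁ xs) ⇔ Subexcedant xs
subexcedant-map-inject₁ xs = mk⇔
  (λ sub j → ≡.subst (_≤ toℕ j) (toℕ-lookup-map j) (sub j))
  (λ sub j → ≡.subst (_≤ toℕ j) (≡.sym (toℕ-lookup-map j)) (sub j))
  where
  toℕ-lookup-map : ∀ j → toℕ (lookup (map inject₁ xs) j) ≡ toℕ (lookup xs j)
  toℕ-lookup-map j = ≡.trans (≡.cong toℕ (lookup-map j inject₁ xs)) (toℕ-inject₁ (lookup xs j))

isOWP⇔subexcedant : ∀ {n} (p : Assignment n) → IsOWP p ⇔ Subexcedant p
isOWP⇔subexcedant p = mk⇔ to from
  where
  to : IsOWP p → Subexcedant p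
  to (_ , above) j with toℕ (lookup p j) ℕₚ.≟ 0
  ... | yes p[j]≡0 = ≡.subst (_≤ toℕ j) (≡.sym p[j]≡0) z≤n
  ... | no  p[j]≢0 =
    ℕₚ.m<1+n⇒m≤n (≡.subst (toℕ (lookup p j) <_) (ℕₚ.+-comm (toℕ j) 1) (above (lookup p j) p[j]≢0 j ≡.refl))
  from : Subexcedant p → IsOWP p
  from sub = (λ j j≡0 → toℕ-injective (ℕₚ.n≤0⇒n≡0 (≡.subst (toℕ (lookup p j) ≤_) j≡0 (sub j))))
           , (λ { i _ j ≡.refl → ≡.subst (toℕ i <_) (ℕₚ.+-comm 1 (toℕ j)) (s≤s (sub j)) })

extend : ∀ {n} → Assignment n → Fin (suc n) → Assignment (suc n)
extend v b = map inject₁ (v ∷ʳ b)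

isOWP-extend : ∀ {n} (v : Assignment n) (b : Fin (suc n)) → IsOWP (extend v b) ⇔ IsOWP v
isOWP-extend v b = mk⇔
  (λ owp → from (isOWP⇔subexcedant v)
             (proj₁ (to (subexcedant-∷ʳ v b)
               (to (subexcedant-map-inject₁ (v ∷ʳ b)) (to (isOWP⇔subexcedant (extend v b)) owp)))))
  (λ owp → from (isOWP⇔subexcedant (extend v b))
             (from (subexcedant-map-inject₁ (v ∷ʳ b))
               (from (subexcedant-∷ʳ v b) (to (isOWP⇔subexcedant v) owp , ℕₚ.m<1+n⇒m≤n (toℕ<n b)))))
  where open Equivalence

foldr-tabulate : ∀ {a b} {A : Set a} {B : Set b} (op : A → B → B) (e : B) {k} (g : Fin k → A) →
                 List.foldr op e (tabulate g) ≡ Vector.foldr op e g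
foldr-tabulate op e {zero}  g = ≡.refl
foldr-tabulate op e {suc k} g = ≡.cong (op (g zero)) (foldr-tabulate op e (g ∘ suc))

module FiniteSums {a ℓ : Level} (R : DifferentialRing a ℓ) where
  open DifferentialRing R hiding (zero)
  open import Algebra.Properties.Semiring.Sum semiring
    using (sum; sum-cong-≋; sum-init-last; sum-replicate-zero; *-distribˡ-sum)
  open import Algebra.Properties.CommutativeMonoid.Sum *-commutativeMonoid
    using () renaming (sum to product; sum-cong-≋ to product-cong; ∑-comm to product-comm;
                       sum-replicate-zero to product-replicate-one)
  open import Algebra.Properties.Group +-group using (identityˡ-unique)
  open import Relation.Binary.Reasoning.Setoid setoid

  D-0 : D 0# ≈ 0#
  D-0 = identityˡ-unique (D 0#) (D 0#) (begin
    D 0# + D 0#   ≈⟨ D-+ 0# 0# ⟨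
    D (0# + 0#)   ≈⟨ D-cong (+-identityʳ 0#) ⟩
    D 0#          ∎)

  D-1 : D 1# ≈ 0#
  D-1 = identityˡ-unique (D 1#) (D 1#) (begin
    D 1# + D 1#             ≈⟨ +-cong (*-identityʳ (D 1#)) (*-identityˡ (D 1#)) ⟨
    D 1# * 1# + 1# * D 1#   ≈⟨ D-* 1# 1# ⟨
    D (1# * 1#)             ≈⟨ D-cong (*-identityʳ 1#) ⟩
    D 1#                    ∎)

  D-sum : ∀ {k} (g : Vector Carrier k) → D (sum g) ≈ sum (D ∘ g)
  D-sum {zero}  g = D-0
  D-sum {suc k} g = trans (D-+ (g zero) (sum (g ∘ suc))) (+-congˡ (D-sum (g ∘ suc)))

  D-product : ∀ {k} (g : Vector Carrier k) → D (product g) ≈ sum (λ b → product (updateAt g b D))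
  D-product {zero}  g = D-1
  D-product {suc k} g = begin
    D (g zero * product (g ∘ suc))
      ≈⟨ D-* (g zero) (product (g ∘ suc)) ⟩
    D (g zero) * product (g ∘ suc) + g zero * D (product (g ∘ suc))
      ≈⟨ +-congˡ (*-congˡ (D-product (g ∘ suc))) ⟩
    D (g zero) * product (g ∘ suc) + g zero * sum (λ b → product (updateAt (g ∘ suc) b D))
      ≈⟨ +-congˡ (*-distribˡ-sum (g zero) (λ b → product (updateAt (g ∘ suc) b D))) ⟩
    sum (λ b → product (updateAt g b D)) ∎

  pow-+ : ∀ x m n → pow R x (m ℕ.+ n) ≈ pow R x m * pow R x n
  pow-+ x zero    n = sym (*-identityˡ (pow R x n))
  pow-+ x (suc m) n = trans (*-congˡ (pow-+ x m n)) (sym (*-assoc x (pow R x m) (pow R x n)))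

  pow-sum : ∀ x {k} (e : Vector ℕ k) → pow R x (ℕΣ.sum e) ≈ product (λ i → pow R x (e i))
  pow-sum x {zero}  e = refl
  pow-sum x {suc k} e = trans (pow-+ x (e zero) (ℕΣ.sum (e ∘ suc))) (*-congˡ (pow-sum x (e ∘ suc)))

  product-delta : ∀ {K} (x : ℕ → Carrier) (a : ℕ) → a < K →
                  product (λ (m : Fin K) → pow R (x (toℕ m)) (indicator (does (a ℕₚ.≟ toℕ m)))) ≈ x a
  -- The indicators `does (a ≟ toℕ m)` compute definitionally on numerals and successors.
  product-delta {suc K} x zero    _ = begin
    (x 0 * 1#) * product {K} (λ _ → 1#) ≈⟨ *-cong (*-identityʳ (x 0)) (product-replicate-one K) ⟩
    x 0 * 1#                           ≈⟨ *-identityʳ (x 0) ⟩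
    x 0                                ∎
  product-delta {suc K} x (suc a) (s≤s a<K) =
    trans (*-identityˡ _) (product-delta (x ∘ suc) a a<K)

  product-pow-count : ∀ {k K} (x : ℕ → Carrier) (s : Fin k → ℕ) → (∀ i → s i < K) →
    product (λ (m : Fin K) → pow R (x (toℕ m)) (ℕΣ.sum (λ i → indicator (does (s i ℕₚ.≟ toℕ m)))))
      ≈ product (λ i → x (s i))
  product-pow-count {k} {K} x s s<K = begin
    product {K} (λ m → pow R (x (toℕ m)) (ℕΣ.sum (λ i → indicator (does (s i ℕₚ.≟ toℕ m)))))
      ≈⟨ product-cong {K} (λ m → pow-sum (x (toℕ m)) (λ i → indicator (does (s i ℕₚ.≟ toℕ m)))) ⟩
    product {K} (λ m → product {k} (λ i → pow R (x (toℕ m)) (indicator (does (s i ℕₚ.≟ toℕ m)))))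
      ≈⟨ product-comm (λ (m : Fin K) (i : Fin k) → pow R (x (toℕ m)) (indicator (does (s i ℕₚ.≟ toℕ m)))) ⟩
    product {k} (λ i → product {K} (λ m → pow R (x (toℕ m)) (indicator (does (s i ℕₚ.≟ toℕ m)))))
      ≈⟨ product-cong {k} (λ i → product-delta x (s i) (s<K i)) ⟩
    product (λ i → x (s i)) ∎

  guard : Bool → Carrier → Carrier
  guard true  x = x
  guard false x = 0#

  guard-congʳ : ∀ t {x y} → x ≈ y → guard t x ≈ guard t y
  guard-congʳ true  x≈y = x≈y
  guard-congʳ false _   = refl

  ∑-map-filter : ∀ {a p} {A : Set a} {P : Pred A p} (P? : Decidable P) (g : A → Carrier) (xs : List A) →
                 ∑ R (List.map g (filter P? xs)) ≈ ∑ R (List.map (λ x → guard (does (P? x)) (g x)) xs)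
  ∑-map-filter P? g []       = refl
  ∑-map-filter P? g (x ∷ xs) with does (P? x)
  ... | true  = +-congˡ (∑-map-filter P? g xs)
  ... | false = trans (∑-map-filter P? g xs) (sym (+-identityˡ _))

  ∑-++ : (xs ys : List Carrier) → ∑ R (xs ++ ys) ≈ ∑ R xs + ∑ R ys
  ∑-++ []       ys = sym (+-identityˡ (∑ R ys))
  ∑-++ (x ∷ xs) ys = trans (+-congˡ (∑-++ xs ys)) (sym (+-assoc x (∑ R xs) (∑ R ys)))

  ∑-map-concatMap : ∀ {a b} {A : Set a} {B : Set b} (g : B → Carrier) (F : A → List B) (xs : List A) →
                    ∑ R (List.map g (concatMap F xs)) ≈ ∑ R (List.map (λ x → ∑ R (List.map g (F x))) xs)
  ∑-map-concatMap g F []       = refl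
  ∑-map-concatMap g F (x ∷ xs) = begin
    ∑ R (List.map g (F x ++ concatMap F xs))
      ≡⟨ ≡.cong (∑ R) (map-++ g (F x) (concatMap F xs)) ⟩
    ∑ R (List.map g (F x) ++ List.map g (concatMap F xs))
      ≈⟨ ∑-++ (List.map g (F x)) (List.map g (concatMap F xs)) ⟩
    ∑ R (List.map g (F x)) + ∑ R (List.map g (concatMap F xs))
      ≈⟨ +-congˡ (∑-map-concatMap g F xs) ⟩
    ∑ R (List.map (λ x → ∑ R (List.map g (F x))) (x ∷ xs)) ∎

  ∑-map-allFin : ∀ {k} (g : Fin k → Carrier) → ∑ R (List.map g (allFin k)) ≡ sum g
  ∑-map-allFin g = ≡.trans (≡.cong (∑ R) (map-tabulate id g)) (foldr-tabulate _+_ 0# g)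

  ∏-map-allFin : ∀ {k} (g : Fin k → Carrier) → ∏ R (List.map g (allFin k)) ≡ product g
  ∏-map-allFin g = ≡.trans (≡.cong (∏ R) (map-tabulate id g)) (foldr-tabulate _*_ 1# g)

  sumVecs : ∀ {k n} → (Vec (Fin k) n → Carrier) → Carrier
  sumVecs {n = zero}  g = g []
  sumVecs {n = suc n} g = sum (λ a → sumVecs (g ∘ (a ∷_)))

  ∑-allVecs : ∀ k n (g : Vec (Fin k) n → Carrier) → ∑ R (List.map g (allVecs k n)) ≈ sumVecs g
  ∑-allVecs k zero    g = +-identityʳ (g [])
  ∑-allVecs k (suc n) g = begin
    ∑ R (List.map g (concatMap (λ a → List.map (a ∷_) (allVecs k n)) (allFin k)))
      ≈⟨ ∑-map-concatMap g (λ a → List.map (a ∷_) (allVecs k n)) (allFin k) ⟩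
    ∑ R (List.map (λ a → ∑ R (List.map g (List.map (a ∷_) (allVecs k n)))) (allFin k))
      ≡⟨ ∑-map-allFin (λ a → ∑ R (List.map g (List.map (a ∷_) (allVecs k n)))) ⟩
    sum (λ a → ∑ R (List.map g (List.map (a ∷_) (allVecs k n))))
      ≈⟨ sum-cong-≋ {k} (λ a → trans (reflexive (≡.cong (∑ R) (≡.sym (map-∘ (allVecs k n)))))
                                     (∑-allVecs k n (g ∘ (a ∷_)))) ⟩
    sumVecs g ∎

  sumVecs-cong : ∀ {k n} {g h : Vec (Fin k) n → Carrier} → (∀ v → g v ≈ h v) → sumVecs g ≈ sumVecs h
  sumVecs-cong {n = zero}  g≈h = g≈h []
  sumVecs-cong {n = suc n} g≈h = sum-cong-≋ (λ a → sumVecs-cong (λ v → g≈h (a ∷ v)))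

  sumVecs-zero : ∀ {k n} (g : Vec (Fin k) n → Carrier) → (∀ v → g v ≈ 0#) → sumVecs g ≈ 0#
  sumVecs-zero {n = zero}  g g≈0 = g≈0 []
  sumVecs-zero {k} {suc n} g g≈0 =
    trans (sum-cong-≋ (λ a → sumVecs-zero (g ∘ (a ∷_)) (λ v → g≈0 (a ∷ v)))) (sum-replicate-zero k)

  sumVecs-homo : (h : Carrier → Carrier) → (∀ {x y} → x ≈ y → h x ≈ h y) →
                 (∀ {k} (g : Vector Carrier k) → h (sum g) ≈ sum (h ∘ g)) →
                 ∀ {k n} (g : Vec (Fin k) n → Carrier) → h (sumVecs g) ≈ sumVecs (h ∘ g)
  sumVecs-homo h h-cong h-sum {n = zero}  g = refl
  sumVecs-homo h h-cong h-sum {n = suc n} g =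
    trans (h-sum (λ a → sumVecs (g ∘ (a ∷_)))) (sum-cong-≋ (λ a → sumVecs-homo h h-cong h-sum (g ∘ (a ∷_))))

  sumVecs-∷ʳ : ∀ {k n} (g : Vec (Fin k) (suc n) → Carrier) →
               sumVecs g ≈ sumVecs {k} {n} (λ v → sum (λ a → g (v ∷ʳ a)))
  sumVecs-∷ʳ {n = zero}  g = refl
  sumVecs-∷ʳ {n = suc n} g = sum-cong-≋ (λ a → sumVecs-∷ʳ (g ∘ (a ∷_)))

  sumVecs-inject₁ : ∀ {k n} (g : Vec (Fin (suc k)) n → Carrier) →
                    (∀ v j → lookup v j ≡ fromℕ k → g v ≈ 0#) →
                    sumVecs g ≈ sumVecs (g ∘ map inject₁)
  sumVecs-inject₁ {n = zero}  g _ = refl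
  sumVecs-inject₁ {k} {suc n} g top⇒0 = begin
    sum (λ a → sumVecs (g ∘ (a ∷_)))
      ≈⟨ sum-init-last (λ a → sumVecs (g ∘ (a ∷_))) ⟩
    sum (λ a → sumVecs (g ∘ (inject₁ a ∷_))) + sumVecs (g ∘ (fromℕ k ∷_))
      ≈⟨ +-cong (sum-cong-≋ (λ a → sumVecs-inject₁ (g ∘ (inject₁ a ∷_)) (λ v j → top⇒0 (inject₁ a ∷ v) (suc j))))
                (sumVecs-zero (g ∘ (fromℕ k ∷_)) (λ v → top⇒0 (fromℕ k ∷ v) zero ≡.refl)) ⟩
    sum (λ a → sumVecs (g ∘ map inject₁ ∘ (a ∷_))) + 0#
      ≈⟨ +-identityʳ _ ⟩
    sumVecs (g ∘ map inject₁) ∎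


module OWPExpansion {a ℓ : Level} (R : DifferentialRing a ℓ) (f : DifferentialRing.Carrier R) where
  open DifferentialRing R hiding (zero)
  open FiniteSums R
  open import Algebra.Properties.Semiring.Sum semiring
    using (sum; sum-cong-≋; sum-cong-≗; sum-replicate-zero; *-distribˡ-sum; *-distribʳ-sum)
  open import Algebra.Properties.CommutativeMonoid.Sum *-commutativeMonoid
    using () renaming (sum to product; sum-cong-≗ to product-cong-≗; sum-init-last to product-init-last)
  open import Relation.Binary.Reasoning.Setoid setoid

  c : ℕ → Carrier
  c k = Dⁿ R k f

  monomial : ∀ {k n} → Vec (Fin k) n → Carrier
  monomial p = product (λ i → c (histogram p i))

  owpTerm : ∀ {n} → Assignment n → Carrier
  owpTerm p = guard (does (isOWP? p)) (monomial p)

  ∏-pow-w≈monomial : ∀ {n} (p : Assignment n) →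
    ∏ R (List.map (λ i → pow R (c (toℕ i)) (w (toℕ i) p)) (allFin (suc n))) ≈ monomial p
  ∏-pow-w≈monomial {n} p = begin
    ∏ R (List.map (λ i → pow R (c (toℕ i)) (w (toℕ i) p)) (allFin (suc n)))
      ≡⟨ ∏-map-allFin {suc n} (λ i → pow R (c (toℕ i)) (w (toℕ i) p)) ⟩
    product {suc n} (λ m → pow R (c (toℕ m)) (w (toℕ m) p))
      ≡⟨ product-cong-≗ {suc n} (λ m → ≡.cong (pow R (c (toℕ m)))
                                 (length-filter-tabulate (λ i → histogram p i ℕₚ.≟ toℕ m) id)) ⟩
    product {suc n} (λ m → pow R (c (toℕ m)) (ℕΣ.sum (λ i → indicator (does (histogram p i ℕₚ.≟ toℕ m)))))
      ≈⟨ product-pow-count c (histogram p) (λ i → s≤s (histogram-≤ p i)) ⟩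
    monomial p ∎

  owpSum≈sumVecs : ∀ n → owpSum R f n ≈ sumVecs (owpTerm {n})
  owpSum≈sumVecs n = begin
    owpSum R f n
      ≈⟨ ∑-map-filter isOWP? F (allVecs (suc n) n) ⟩
    ∑ R (List.map (λ p → guard (does (isOWP? p)) (F p)) (allVecs (suc n) n))
      ≈⟨ ∑-allVecs (suc n) n (λ p → guard (does (isOWP? p)) (F p)) ⟩
    sumVecs {suc n} {n} (λ p → guard (does (isOWP? p)) (F p))
      ≈⟨ sumVecs-cong {suc n} {n} (λ p → guard-congʳ (does (isOWP? p)) (∏-pow-w≈monomial p)) ⟩
    sumVecs (owpTerm {n}) ∎
    where
    F : Assignment n → Carrier
    F p = ∏ R (List.map (λ i → pow R (c (toℕ i)) (w (toℕ i) p)) (allFin (suc n)))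

  monomial-extend : ∀ {n} (v : Assignment n) (b : Fin (suc n)) →
                    monomial (extend v b) ≈ product (updateAt (c ∘ histogram v) b D) * f
  monomial-extend {n} v b = begin
    monomial (extend v b)
      ≈⟨ product-init-last (λ i → c (histogram (extend v b) i)) ⟩
    product (λ i → c (histogram (extend v b) (inject₁ i)))
      * c (histogram (extend v b) (fromℕ (suc n)))
      ≡⟨ ≡.cong₂ _*_ (product-cong-≗ {suc n} new-blocks) (≡.cong c top-block) ⟩
    product (updateAt (c ∘ histogram v) b D) * f ∎
    where
    new-blocks : ∀ i → c (histogram (extend v b) (inject₁ i)) ≡ updateAt (c ∘ histogram v) b D i
    new-blocks i = ≡.trans (≡.cong c (≡.trans (histogram-map inject₁-injective (v ∷ʳ b) i)
                                              (histogram-∷ʳ v b i)))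
                           (map-updateAt {f = c} {g = suc} {h = D} (λ _ → ≡.refl) (histogram v) b i)
    top-block : histogram (extend v b) (fromℕ (suc n)) ≡ 0
    top-block = histogram-∉ (extend v b) (fromℕ (suc n))
                  (λ j eq → fromℕ≢inject₁ (≡.trans (≡.sym eq) (lookup-map j inject₁ (v ∷ʳ b))))

  ∑-monomial-extend : ∀ {n} (v : Assignment n) → sum (λ b → monomial (extend v b)) ≈ f * D (monomial v)
  ∑-monomial-extend {n} v = begin
    sum (λ b → monomial (extend v b))
      ≈⟨ sum-cong-≋ {suc n} (monomial-extend v) ⟩
    sum (λ b → product (updateAt (c ∘ histogram v) b D) * f)
      ≈⟨ *-distribʳ-sum f (λ b → product (updateAt (c ∘ histogram v) b D)) ⟨
    sum (λ b → product (updateAt (c ∘ histogram v) b D)) * f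
      ≈⟨ *-congʳ (D-product (c ∘ histogram v)) ⟨
    D (monomial v) * f
      ≈⟨ *-comm (D (monomial v)) f ⟩
    f * D (monomial v) ∎

  ∑-owpTerm-extend : ∀ {n} (v : Assignment n) → sum (λ b → owpTerm (extend v b)) ≈ f * D (owpTerm v)
  ∑-owpTerm-extend {n} v = begin
    sum (λ b → owpTerm (extend v b))
      ≡⟨ sum-cong-≗ {suc n} (λ b → ≡.cong (λ t → guard t (monomial (extend v b)))
                                          (does-⇔ (isOWP-extend v b) (isOWP? (extend v b)) (isOWP? v))) ⟩
    sum (λ b → guard (does (isOWP? v)) (monomial (extend v b)))
      ≈⟨ guarded (does (isOWP? v)) ⟩
    f * D (owpTerm v) ∎
    where
    guarded : ∀ t → sum (λ b → guard t (monomial (extend v b))) ≈ f * D (guard t (monomial v))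
    guarded true  = ∑-monomial-extend v
    guarded false = begin
      sum {suc n} (λ _ → 0#) ≈⟨ sum-replicate-zero (suc n) ⟩
      0#                     ≈⟨ zeroʳ f ⟨
      f * 0#                 ≈⟨ *-congˡ D-0 ⟨
      f * D 0#               ∎

  owpTerm-top≈0 : ∀ {n} (p : Assignment (suc n)) j → lookup p j ≡ fromℕ (suc n) → owpTerm p ≈ 0#
  owpTerm-top≈0 p j p[j]≡top
    rewrite dec-false (isOWP? p) (λ owp → subexcedant-lookup≢fromℕ {xs = p}
                                            (Equivalence.to (isOWP⇔subexcedant p) owp) j p[j]≡top)
    = refl

  sumVecs-owpTerm : ∀ n → sumVecs (owpTerm {n}) ≈ cDpow R f n
  sumVecs-owpTerm zero    = *-identityʳ f
  sumVecs-owpTerm (suc n) = begin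
    sumVecs (owpTerm {suc n})
      ≈⟨ sumVecs-inject₁ {suc n} {suc n} owpTerm owpTerm-top≈0 ⟩
    sumVecs {suc n} {suc n} (owpTerm ∘ map inject₁)
      ≈⟨ sumVecs-∷ʳ {suc n} {n} (owpTerm ∘ map inject₁) ⟩
    sumVecs {suc n} {n} (λ v → sum (λ b → owpTerm (extend v b)))
      ≈⟨ sumVecs-cong {suc n} {n} ∑-owpTerm-extend ⟩
    sumVecs {suc n} {n} (λ v → f * D (owpTerm v))
      ≈⟨ sumVecs-homo (f *_) *-congˡ (*-distribˡ-sum f) {suc n} {n} (D ∘ owpTerm) ⟨
    f * sumVecs (D ∘ owpTerm {n})
      ≈⟨ *-congˡ (sumVecs-homo D D-cong D-sum {suc n} {n} owpTerm) ⟨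
    f * D (sumVecs (owpTerm {n}))
      ≈⟨ *-congˡ (D-cong (sumVecs-owpTerm n)) ⟩
    cDpow R f (suc n) ∎

-- The identity also holds for n = 0, where OWP₀ consists of the single empty partition.
lemma4p3 : ∀ {c ℓ : Level} (R : DifferentialRing c ℓ) (f : DifferentialRing.Carrier R)
             (n : ℕ) → 1 ≤ n →
             DifferentialRing._≈_ R (cDpow R f n) (owpSum R f n)
lemma4p3 R f n _ = trans (sym (sumVecs-owpTerm n)) (sym (owpSum≈sumVecs n))
  where
  open DifferentialRing R using (sym; trans)
  open OWPExpansion R f
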